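{- For $r\ge 2$, let $H(r)$ be the graph obtained from two disjoint copies of $K_{r+2}$ by adding a matching between $r$ pairs of vertices (each pair consisting of one vertex from each copy). Then $\operatorname{Z}_-(H(r))=r$, $\overline{\operatorname{Z}}_-(H(r))=r+1$, and $z^-_0(H(r))=2r=\overline{\operatorname{Z}}_-(H(r))+r-1$.
   Context: All graphs are finite, simple, undirected. Skew color change rule: given the current white set $W$, any vertex $u$ may turn a white vertex $w$ blue if $N(u)\cap W=\{w\}$. A skew forcing set is a set $S$ such that starting with exactly $S$ blue, repeated application makes every vertex blue. $\operatorname{Z}_-(G)$ is the minimum size of a skew forcing set, $\overline{\operatorname{Z}}_-(G)$ the maximum size of an inclusion-minimal skew forcing set. The skew TAR graph $\mathfrak{Z}^-(G)$ has the skew forcing sets as vertices, two adjacent iff their symmetric difference has exactly one element; $\mathfrak{Z}^-_k(G)$ is its subgraph induced by skew forcing sets of size at most $k$, and $z^-_0(G)$ is the least $k_0$ such that $\mathfrak{Z}^-_k(G)$ is connected for all $k\ge k_0$. -}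

module Defs where

open import Data.Nat using (ℕ; _+_; _≤_; _<_)
open import Data.Fin using (Fin; toℕ; splitAt)
open import Data.Fin.Subset using (Subset; _∈_; _∉_; _∪_; ⁅_⁆; ∣_∣; _⊆_)
open import Data.Vec using (lookup)
open import Data.Sum using (_⊎_; inj₁; inj₂)
open import Data.Product using (_×_; ∃)
open import Data.Empty using (⊥)
open import Relation.Nullary using (¬_)
open import Relation.Binary.PropositionalEquality using (_≡_; _≢_)

Graph : ℕ → Set₁
Graph n = Fin n → Fin n → Set

module _ {n : ℕ} (G : Graph n) where

  SkewForce : Subset n → Fin n → Fin n → Set
  SkewForce B u w = (w ∉ B) × G u w × (∀ v → G u v → v ≢ w → v ∈ B)

  data SkewDerives : Subset n → Set where
    allBlue : ∀ {B} → (∀ v → v ∈ B) → SkewDerives B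
    force   : ∀ {B} u w → SkewForce B u w → SkewDerives (⁅ w ⁆ ∪ B) → SkewDerives B

  IsSkewForcingSet : Subset n → Set
  IsSkewForcingSet S = SkewDerives S

  IsMinimalSkewForcingSet : Subset n → Set
  IsMinimalSkewForcingSet S =
    IsSkewForcingSet S × (∀ T → T ⊆ S → IsSkewForcingSet T → S ⊆ T)

  TARAdj : Subset n → Subset n → Set
  TARAdj S T = ∃ λ v → (lookup S v ≢ lookup T v) × (∀ u → u ≢ v → lookup S u ≡ lookup T u)

  InTAR : ℕ → Subset n → Set
  InTAR k S = IsSkewForcingSet S × ∣ S ∣ ≤ k

  data TARPath (k : ℕ) : Subset n → Subset n → Set where
    here : ∀ {S} → TARPath k S S
    step : ∀ {S S' T} → TARAdj S S' → InTAR k S' → TARPath k S' T → TARPath k S T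

  TARConnected : ℕ → Set
  TARConnected k = ∀ S T → InTAR k S → InTAR k T → TARPath k S T

  SkewForcingNumberIs : ℕ → Set
  SkewForcingNumberIs m =
    (∃ λ S → IsSkewForcingSet S × ∣ S ∣ ≡ m) × (∀ S → IsSkewForcingSet S → m ≤ ∣ S ∣)

  UpperSkewForcingNumberIs : ℕ → Set
  UpperSkewForcingNumberIs m =
    (∃ λ S → IsMinimalSkewForcingSet S × ∣ S ∣ ≡ m)
    × (∀ S → IsMinimalSkewForcingSet S → ∣ S ∣ ≤ m)

  SkewTARConnThresholdIs : ℕ → Set
  SkewTARConnThresholdIs m =
    (∀ k → m ≤ k → TARConnected k)
    × (∀ k₀ → (∀ k → k₀ ≤ k → TARConnected k) → m ≤ k₀)

-- H(r): two copies of K_{r+2} on Fin (r+2) ⊎ Fin (r+2) (encoded via splitAt),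
-- plus the matching (inj₁ i) — (inj₂ i) for the r indices i with toℕ i < r.
HAdj' : (r : ℕ) → Fin (r + 2) ⊎ Fin (r + 2) → Fin (r + 2) ⊎ Fin (r + 2) → Set
HAdj' r (inj₁ a) (inj₁ b) = a ≢ b
HAdj' r (inj₂ a) (inj₂ b) = a ≢ b
HAdj' r (inj₁ a) (inj₂ b) = (a ≡ b) × (toℕ a < r)
HAdj' r (inj₂ a) (inj₁ b) = (a ≡ b) × (toℕ a < r)

H : (r : ℕ) → Graph ((r + 2) + (r + 2))
H r x y = HAdj' r (splitAt (r + 2) x) (splitAt (r + 2) y)

-- View H(r) as two cliques, left and right, on Fin (r + 2), matched along the first r indices.
-- The first force of any skew forcing process happens inside one clique: some vertex x has every
-- neighbour blue except a clique-mate y.  Conversely such a configuration (Ready) always lets forcing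
-- continue, so the skew forcing sets are exactly the sets Ready on some side.  Being Ready requires
-- the r clique vertices other than x and y, so Z₋ = r; an inclusion-minimal forcing set consists of
-- these and possibly the partner of x, so Z̄₋ = r + 1, attained when x is matched (here r ≥ 2 is used).
-- For k ≥ 2r every forcing set is joined in 𝔷⁻_k to the full clique of its side, and the two full
-- cliques are joined through a set of size 2r.  For k < 2r a walk from the minimum forcing set on the
-- left keeps r blue left vertices, because a set Ready on the right with r blue left vertices has 2r
-- elements; so it never reaches the minimum forcing set on the right.
module Submission where

open import Defs
open import Data.Bool using (true; false)
open import Data.Empty using (⊥-elim)
open import Data.Fin using (Fin; zero; suc; toℕ; fromℕ<; _↑ˡ_; _↑ʳ_; splitAt) renaming (_≟_ to _≟ᶠ_)
open import Data.Fin.Properties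
  using (toℕ-fromℕ<; toℕ-injective; toℕ<n; all?; any?; ¬∀⟶∃¬; splitAt-↑ˡ; splitAt-↑ʳ; splitAt⁻¹-↑ˡ; splitAt⁻¹-↑ʳ)
open import Data.Fin.Subset using (Subset; _∈_; _∉_; _⊆_; _∪_; _∩_; ∁; ⁅_⁆; _-_; ∣_∣; ⊤; ⊥; inside; outside)
open import Data.Fin.Subset.Properties
  using ( _∈?_; ∈⊤; ⊆⊤; ⊥⊆; ⊆-refl; ⊆-trans; ⊆-antisym; x∈⁅x⁆; x∈⁅y⁆⇒x≡y; ∣⁅x⁆∣≡1; ∣⊥∣≡0; ∣⊤∣≡n; ∣∁p∣≡n∸∣p∣
        ; ∣p∣≤∣x∷p∣; p⊆q⇒∣p∣≤∣q∣; p⊂q⇒∣p∣<∣q∣; x∈p∩q⁺; x∈p∩q⁻; p∩q⊆p; p∩q⊆q; x∈p∪q⁺; x∈p∪q⁻; p⊆p∪q; q⊆p∪q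
        ; x∉p⇒x∈∁p; x∈∁p⇒x∉p; x∈p⇒x∉∁p; p─q⊆p; x∈p∧x≢y⇒x∈p-y; x∈p⇒∣p-x∣<∣p∣ )
open import Data.Nat using (ℕ; zero; suc; _≤_; _<_; _+_; _*_; _∸_; _⊔_; z≤n; s≤s; _<?_; _≤?_)
open import Data.Nat.Properties
  using ( _≟_; ≤-refl; ≤-trans; ≤-reflexive; ≤-antisym; ≤-pred; <-≤-trans; <-irrefl; <-asym; <⇒≤; <⇒≱; ≰⇒>
        ; ≮⇒≥; ≤∧≢⇒<; n≤1+n; n<1+n; 1+n≢n; 0≢1+n; n≤0⇒n≡0; m<m+n; m≤m+n; m≤n+m; m+n∸n≡m
        ; +-suc; +-comm; +-identityʳ; +-monoʳ-≤; +-mono-≤; ⊔-lub; m≤m⊔n; m≤n⊔m )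
open import Data.Product using (_×_; _,_; ∃; ∃₂; proj₁; proj₂)
open import Data.Sum using (_⊎_; inj₁; inj₂; [_,_])
open import Data.Vec using (_++_; []; _∷_; lookup; take; drop; here; there)
open import Data.Vec.Properties using ([]=⇒lookup; lookup⇒[]=; lookup-++ˡ; lookup-++ʳ; take++drop≡id)
open import Relation.Binary.Definitions using (DecidableEquality)
open import Relation.Binary.PropositionalEquality
  using (_≡_; _≢_; refl; sym; trans; cong; cong₂; subst; subst₂; module ≡-Reasoning)
open import Relation.Nullary using (¬_; Dec; yes; no; ¬?)
open import Relation.Nullary.Decidable using (_×-dec_)

private
  variable
    n : ℕ

-- Counting in finite subsets

∣p++q∣≡∣p∣+∣q∣ : ∀ {a b} (p : Subset a) (q : Subset b) → ∣ p ++ q ∣ ≡ ∣ p ∣ + ∣ q ∣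
∣p++q∣≡∣p∣+∣q∣ []            q = refl
∣p++q∣≡∣p∣+∣q∣ (inside ∷ p)  q = cong suc (∣p++q∣≡∣p∣+∣q∣ p q)
∣p++q∣≡∣p∣+∣q∣ (outside ∷ p) q = ∣p++q∣≡∣p∣+∣q∣ p q

∣p∪q∣≤∣p∣+∣q∣ : (p q : Subset n) → ∣ p ∪ q ∣ ≤ ∣ p ∣ + ∣ q ∣
∣p∪q∣≤∣p∣+∣q∣ []            []            = z≤n
∣p∪q∣≤∣p∣+∣q∣ (inside ∷ p)  (s ∷ q)       = s≤s (≤-trans (∣p∪q∣≤∣p∣+∣q∣ p q) (+-monoʳ-≤ ∣ p ∣ (∣p∣≤∣x∷p∣ s q)))
∣p∪q∣≤∣p∣+∣q∣ (outside ∷ p) (inside ∷ q)  = ≤-trans (s≤s (∣p∪q∣≤∣p∣+∣q∣ p q)) (≤-reflexive (sym (+-suc ∣ p ∣ ∣ q ∣)))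
∣p∪q∣≤∣p∣+∣q∣ (outside ∷ p) (outside ∷ q) = ∣p∪q∣≤∣p∣+∣q∣ p q

x∉p⇒∣p∣<n : ∀ {x} {p : Subset n} → x ∉ p → ∣ p ∣ < n
x∉p⇒∣p∣<n {n} {x} {p} x∉p = <-≤-trans (p⊂q⇒∣p∣<∣q∣ (⊆⊤ , x , ∈⊤ , x∉p)) (≤-reflexive (∣⊤∣≡n n))

x∉p-x : ∀ (p : Subset n) x → x ∉ p - x
x∉p-x (_ ∷ p) (suc x) (there x∈p-x) = x∉p-x p x x∈p-x

∈-transport : ∀ {a b} {p : Subset a} {q : Subset b} {x y} → lookup p x ≡ lookup q y → x ∈ p → y ∈ q
∈-transport {q = q} {y = y} e x∈p = lookup⇒[]= y q (trans (sym e) ([]=⇒lookup x∈p))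

∈⇔⇒lookup≡ : ∀ {x} {p q : Subset n} → (x ∈ p → x ∈ q) → (x ∈ q → x ∈ p) → lookup p x ≡ lookup q x
∈⇔⇒lookup≡ {x = x} {p} {q} p⇒q q⇒p with lookup p x in ep | lookup q x in eq
... | true  | true  = refl
... | false | false = refl
... | true  | false = trans (sym ([]=⇒lookup (p⇒q (lookup⇒[]= x p ep)))) eq
... | false | true  = trans (sym ep) ([]=⇒lookup (q⇒p (lookup⇒[]= x q eq)))

∈∉⇒lookup≢ : ∀ {x} {p q : Subset n} → x ∈ p → x ∉ q → lookup p x ≢ lookup q x
∈∉⇒lookup≢ {x = x} {p} {q} x∈p x∉q e = x∉q (lookup⇒[]= x q (trans (sym e) ([]=⇒lookup x∈p)))

allBut : Fin n → Fin n → Subset n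
allBut x y = ∁ (⁅ x ⁆ ∪ ⁅ y ⁆)

∈allBut⁺ : ∀ {x y a : Fin n} → a ≢ x → a ≢ y → a ∈ allBut x y
∈allBut⁺ {x = x} {y} {a} a≢x a≢y = x∉p⇒x∈∁p λ a∈xy → not-x-or-y (x∈p∪q⁻ ⁅ x ⁆ ⁅ y ⁆ a∈xy)
  where
  not-x-or-y : ¬ (a ∈ ⁅ x ⁆ ⊎ a ∈ ⁅ y ⁆)
  not-x-or-y (inj₁ a∈x) = a≢x (x∈⁅y⁆⇒x≡y x a∈x)
  not-x-or-y (inj₂ a∈y) = a≢y (x∈⁅y⁆⇒x≡y y a∈y)

∈allBut⁻ : ∀ {x y a : Fin n} → a ∈ allBut x y → a ≢ x × a ≢ y
∈allBut⁻ {x = x} {y} a∈ =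
  (λ { refl → x∈∁p⇒x∉p a∈ (x∈p∪q⁺ (inj₁ (x∈⁅x⁆ x))) }) , (λ { refl → x∈∁p⇒x∉p a∈ (x∈p∪q⁺ (inj₂ (x∈⁅x⁆ y))) })

∉allBut⇒∈pair : ∀ {x y c : Fin n} → c ∉ allBut x y → c ≡ x ⊎ c ≡ y
∉allBut⇒∈pair {x = x} {y} {c} c∉ with c ≟ᶠ x | c ≟ᶠ y
... | yes c≡x | _       = inj₁ c≡x
... | no  _   | yes c≡y = inj₂ c≡y
... | no  c≢x | no  c≢y = ⊥-elim (c∉ (∈allBut⁺ c≢x c≢y))

allBut⊆∁⁅y⁆ : ∀ {x y : Fin n} → allBut x y ⊆ ∁ ⁅ y ⁆
allBut⊆∁⁅y⁆ {y = y} a∈ = x∉p⇒x∈∁p λ a∈y → proj₂ (∈allBut⁻ a∈) (x∈⁅y⁆⇒x≡y y a∈y)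

∣⁅x⁆∪⁅y⁆∣≡2 : ∀ {x y : Fin n} → x ≢ y → ∣ ⁅ x ⁆ ∪ ⁅ y ⁆ ∣ ≡ 2
∣⁅x⁆∪⁅y⁆∣≡2 {x = x} {y} x≢y = ≤-antisym at-most at-least
  where
  at-most : ∣ ⁅ x ⁆ ∪ ⁅ y ⁆ ∣ ≤ 2
  at-most = subst (∣ ⁅ x ⁆ ∪ ⁅ y ⁆ ∣ ≤_) (cong₂ _+_ (∣⁅x⁆∣≡1 x) (∣⁅x⁆∣≡1 y)) (∣p∪q∣≤∣p∣+∣q∣ ⁅ x ⁆ ⁅ y ⁆)
  at-least : 2 ≤ ∣ ⁅ x ⁆ ∪ ⁅ y ⁆ ∣
  at-least = subst (_< ∣ ⁅ x ⁆ ∪ ⁅ y ⁆ ∣) (∣⁅x⁆∣≡1 x)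
    (p⊂q⇒∣p∣<∣q∣ (p⊆p∪q ⁅ y ⁆ , y , x∈p∪q⁺ (inj₂ (x∈⁅x⁆ y)) , λ y∈x → x≢y (sym (x∈⁅y⁆⇒x≡y x y∈x))))

∣allBut∣≡n∸2 : ∀ {x y : Fin n} → x ≢ y → ∣ allBut x y ∣ ≡ n ∸ 2
∣allBut∣≡n∸2 {n} {x} {y} x≢y = trans (∣∁p∣≡n∸∣p∣ (⁅ x ⁆ ∪ ⁅ y ⁆)) (cong (n ∸_) (∣⁅x⁆∪⁅y⁆∣≡2 x≢y))

-- Skew forcing and the TAR graph of an arbitrary graph

module _ {n : ℕ} (G : Graph n) where

  SkewDerives-mono : ∀ {B B′} → SkewDerives G B → B ⊆ B′ → SkewDerives G B′
  SkewDerives-mono (allBlue all∈B) B⊆B′ = allBlue (λ v → B⊆B′ (all∈B v))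
  SkewDerives-mono {B′ = B′} (force u w (w∉B , uw , rest) d) B⊆B′ with w ∈? B′
  ... | yes w∈B′ = SkewDerives-mono d wB⊆B′
    where
    wB⊆B′ : ⁅ w ⁆ ∪ _ ⊆ B′
    wB⊆B′ v∈ with x∈p∪q⁻ ⁅ w ⁆ _ v∈
    ... | inj₁ v∈w = subst (_∈ B′) (sym (x∈⁅y⁆⇒x≡y w v∈w)) w∈B′
    ... | inj₂ v∈B = B⊆B′ v∈B
  ... | no w∉B′ = force u w (w∉B′ , uw , λ v uv v≢w → B⊆B′ (rest v uv v≢w)) (SkewDerives-mono d wB⊆wB′)
    where
    wB⊆wB′ : ⁅ w ⁆ ∪ _ ⊆ ⁅ w ⁆ ∪ B′
    wB⊆wB′ v∈ with x∈p∪q⁻ ⁅ w ⁆ _ v∈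
    ... | inj₁ v∈w = x∈p∪q⁺ (inj₁ v∈w)
    ... | inj₂ v∈B = x∈p∪q⁺ (inj₂ (B⊆B′ v∈B))

  SkewDerives-from-invariant : (P : Subset n → Set) →
    (∀ {B} w → P B → P (⁅ w ⁆ ∪ B)) →
    (∀ {B v} → P B → v ∉ B → ∃₂ (SkewForce G B)) →
    ∀ {B} → P B → SkewDerives G B
  SkewDerives-from-invariant P preserved progress {B} = derive n (m≤m+n n ∣ B ∣)
    where
    derive : ∀ {B} fuel → n ≤ fuel + ∣ B ∣ → P B → SkewDerives G B
    derive {B} fuel n≤ pB with all? (_∈? B)
    ... | yes all∈B = allBlue all∈B
    ... | no not-all with ¬∀⟶∃¬ n _ (_∈? B) not-all
    derive zero n≤ pB | no _ | v , v∉B = ⊥-elim (<⇒≱ (x∉p⇒∣p∣<n v∉B) n≤)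
    derive {B} (suc fuel) n≤ pB | no _ | v , v∉B with progress pB v∉B
    ... | u , w , f@(w∉B , _) = force u w f (derive fuel n≤′ (preserved w pB))
      where
      grows : ∣ B ∣ < ∣ ⁅ w ⁆ ∪ B ∣
      grows = p⊂q⇒∣p∣<∣q∣ (q⊆p∪q ⁅ w ⁆ B , w , x∈p∪q⁺ (inj₁ (x∈⁅x⁆ w)) , w∉B)
      n≤′ : n ≤ fuel + ∣ ⁅ w ⁆ ∪ B ∣
      n≤′ = ≤-trans n≤ (≤-trans (≤-reflexive (sym (+-suc fuel ∣ B ∣))) (+-monoʳ-≤ fuel grows))

module _ {n : ℕ} {G : Graph n} where

  TARAdj-sym : ∀ {S T} → TARAdj G S T → TARAdj G T S
  TARAdj-sym (v , differ , agree) = v , (λ e → differ (sym e)) , (λ u u≢v → sym (agree u u≢v))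

  TARAdj-remove : ∀ {S v} → v ∈ S → TARAdj G S (S - v)
  TARAdj-remove {S} {v} v∈S =
    v , ∈∉⇒lookup≢ v∈S (x∉p-x S v) ,
    λ u u≢v → ∈⇔⇒lookup≡ (λ u∈S → x∈p∧x≢y⇒x∈p-y u∈S u≢v) (p─q⊆p S ⁅ v ⁆)

  infixr 5 _◅◅_

  _◅◅_ : ∀ {k S T U} → TARPath G k S T → TARPath G k T U → TARPath G k S U
  here             ◅◅ q = q
  step adj inS p ◅◅ q = step adj inS (p ◅◅ q)

  reverse : ∀ {k S T} → InTAR G k S → TARPath G k S T → TARPath G k T S
  reverse inS p = go inS p here
    where
    go : ∀ {k S T U} → InTAR G k S → TARPath G k S T → TARPath G k S U → TARPath G k T U
    go inS here               acc = acc
    go {S = S} inS (step {S' = S′} adj inS′ p) acc = go inS′ p (step (TARAdj-sym {S} {S′} adj) inS acc)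

  -- Removing the vertices of S ∖ R one at a time stays among skew forcing sets, because they all contain R.
  path-down : ∀ {k R S} → R ⊆ S → IsSkewForcingSet G R → ∣ S ∣ ≤ k → TARPath G k S R
  path-down {k} {R} {S} R⊆S forcing ∣S∣≤k = go ∣ S ∣ ≤-refl R⊆S ∣S∣≤k
    where
    go : ∀ {S} fuel → ∣ S ∣ ≤ fuel → R ⊆ S → ∣ S ∣ ≤ k → TARPath G k S R
    go {S} fuel ∣S∣≤fuel R⊆S ∣S∣≤k with any? (λ v → v ∈? S ×-dec ¬? (v ∈? R))
    ... | no S⊆R = subst (TARPath G k S) (⊆-antisym S⊆R′ R⊆S) here
      where
      S⊆R′ : S ⊆ R
      S⊆R′ {v} v∈S with v ∈? R
      ... | yes v∈R = v∈R
      ... | no  v∉R = ⊥-elim (S⊆R (v , v∈S , v∉R))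
    go {S} zero ∣S∣≤0 R⊆S ∣S∣≤k | yes (v , v∈S , _) = ⊥-elim (<⇒≱ (x∈p⇒∣p-x∣<∣p∣ v∈S) (≤-trans ∣S∣≤0 z≤n))
    go {S} (suc fuel) ∣S∣≤ R⊆S ∣S∣≤k | yes (v , v∈S , v∉R) =
      step (TARAdj-remove v∈S) (SkewDerives-mono G forcing R⊆S-v , ∣S-v∣≤k) (go fuel ∣S-v∣≤fuel R⊆S-v ∣S-v∣≤k)
      where
      R⊆S-v : R ⊆ S - v
      R⊆S-v {u} u∈R = x∈p∧x≢y⇒x∈p-y (R⊆S u∈R) λ { refl → v∉R u∈R }
      ∣S-v∣<∣S∣ : ∣ S - v ∣ < ∣ S ∣
      ∣S-v∣<∣S∣ = x∈p⇒∣p-x∣<∣p∣ v∈S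
      ∣S-v∣≤k : ∣ S - v ∣ ≤ k
      ∣S-v∣≤k = ≤-trans (<⇒≤ ∣S-v∣<∣S∣) ∣S∣≤k
      ∣S-v∣≤fuel : ∣ S - v ∣ ≤ fuel
      ∣S-v∣≤fuel = ≤-pred (≤-trans ∣S-v∣<∣S∣ ∣S∣≤)

  path-via : ∀ {k R S T} → R ⊆ S → R ⊆ T → IsSkewForcingSet G R → ∣ S ∣ ≤ k → ∣ T ∣ ≤ k → TARPath G k S T
  path-via R⊆S R⊆T forcing ∣S∣≤k ∣T∣≤k =
    path-down R⊆S forcing ∣S∣≤k
    ◅◅ reverse (SkewDerives-mono G forcing R⊆T , ∣T∣≤k) (path-down R⊆T forcing ∣T∣≤k)

-- The graph H(r)

data Side : Set where
  left right : Side

opposite : Side → Side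
opposite left  = right
opposite right = left

opposite-≢ : ∀ s → opposite s ≢ s
opposite-≢ left  ()
opposite-≢ right ()

≢⇒≡opposite : ∀ {s t} → t ≢ s → t ≡ opposite s
≢⇒≡opposite {left}  {left}  t≢s = ⊥-elim (t≢s refl)
≢⇒≡opposite {left}  {right} t≢s = refl
≢⇒≡opposite {right} {left}  t≢s = refl
≢⇒≡opposite {right} {right} t≢s = ⊥-elim (t≢s refl)

_≟ˢ_ : DecidableEquality Side
left  ≟ˢ left  = yes refl
right ≟ˢ right = yes refl
left  ≟ˢ right = no λ ()
right ≟ˢ left  = no λ ()

-- vertex s a is the vertex a of the clique on side s; the matching edges join vertex left a and
-- vertex right a for the Matched indices a, and u₀, u₁ below are the two unmatched ones.
module _ (r : ℕ) where
  open ≡-Reasoning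

  m : ℕ
  m = r + 2

  Matched : Fin m → Set
  Matched a = toℕ a < r

  Matched? : ∀ a → Dec (Matched a)
  Matched? a = toℕ a <? r

  vertex : Side → Fin m → Fin (m + m)
  vertex left  a = a ↑ˡ m
  vertex right a = m ↑ʳ a

  private
    tag : Side → Fin m → Fin m ⊎ Fin m
    tag left  = inj₁
    tag right = inj₂

    splitAt-vertex : ∀ s a → splitAt m (vertex s a) ≡ tag s a
    splitAt-vertex left  a = splitAt-↑ˡ m a m
    splitAt-vertex right a = splitAt-↑ʳ m m a

    H-vertex : ∀ s a t b → H r (vertex s a) (vertex t b) ≡ HAdj' r (tag s a) (tag t b)
    H-vertex s a t b = cong₂ (HAdj' r) (splitAt-vertex s a) (splitAt-vertex t b)

  vertex-surjective : ∀ v → ∃₂ λ s a → v ≡ vertex s a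
  vertex-surjective v with splitAt m v in eq
  ... | inj₁ a = left  , a , sym (splitAt⁻¹-↑ˡ eq)
  ... | inj₂ a = right , a , sym (splitAt⁻¹-↑ʳ eq)

  vertex-injective : ∀ {s t a b} → vertex s a ≡ vertex t b → s ≡ t × a ≡ b
  vertex-injective {s} {t} {a} {b} e =
    untag s t (trans (sym (splitAt-vertex s a)) (trans (cong (splitAt m) e) (splitAt-vertex t b)))
    where
    untag : ∀ s t → tag s a ≡ tag t b → s ≡ t × a ≡ b
    untag left  left  refl = refl , refl
    untag right right refl = refl , refl

  vertex-≢ : ∀ s {a b} → a ≢ b → vertex s a ≢ vertex s b
  vertex-≢ s {a} {b} a≢b e = a≢b (proj₂ (vertex-injective {s} {s} {a} {b} e))

  vertex-opposite-≢ : ∀ s {a b} → vertex (opposite s) a ≢ vertex s b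
  vertex-opposite-≢ s {a} {b} e = opposite-≢ s (proj₁ (vertex-injective {opposite s} {s} {a} {b} e))

  H-neighbour : ∀ s {a v} → H r (vertex s a) v →
    (∃ λ b → v ≡ vertex s b × a ≢ b) ⊎ (v ≡ vertex (opposite s) a × Matched a)
  H-neighbour s {a} {v} adj with vertex-surjective v
  ... | t , b , refl = cases s t (subst (λ A → A) (H-vertex s a t b) adj)
    where
    cases : ∀ s t → HAdj' r (tag s a) (tag t b) →
      (∃ λ c → vertex t b ≡ vertex s c × a ≢ c) ⊎ (vertex t b ≡ vertex (opposite s) a × Matched a)
    cases left  left  a≢b            = inj₁ (b , refl , a≢b)
    cases right right a≢b            = inj₁ (b , refl , a≢b)
    cases left  right (refl , a<r)   = inj₂ (refl , a<r)
    cases right left  (refl , a<r)   = inj₂ (refl , a<r)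

  H-clique : ∀ s {a b} → a ≢ b → H r (vertex s a) (vertex s b)
  H-clique left  a≢b = subst (λ A → A) (sym (H-vertex left  _ left  _)) a≢b
  H-clique right a≢b = subst (λ A → A) (sym (H-vertex right _ right _)) a≢b

  H-matching : ∀ s {a} → Matched a → H r (vertex s a) (vertex (opposite s) a)
  H-matching left  a<r = subst (λ A → A) (sym (H-vertex left  _ right _)) (refl , a<r)
  H-matching right a<r = subst (λ A → A) (sym (H-vertex right _ left  _)) (refl , a<r)

  private
    2+r≤m : 2 + r ≤ m
    2+r≤m = ≤-reflexive (+-comm 2 r)

  u₀ u₁ : Fin m
  u₀ = fromℕ< (≤-trans (n≤1+n (suc r)) 2+r≤m)
  u₁ = fromℕ< 2+r≤m

  toℕ-u₀ : toℕ u₀ ≡ r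
  toℕ-u₀ = toℕ-fromℕ< _

  toℕ-u₁ : toℕ u₁ ≡ suc r
  toℕ-u₁ = toℕ-fromℕ< _

  u₀≢u₁ : u₀ ≢ u₁
  u₀≢u₁ e = 1+n≢n (trans (sym toℕ-u₁) (trans (cong toℕ (sym e)) toℕ-u₀))

  unmatched-u₀ : ¬ Matched u₀
  unmatched-u₀ u₀<r = <-irrefl toℕ-u₀ u₀<r

  unmatched-u₁ : ¬ Matched u₁
  unmatched-u₁ u₁<r = <-asym (subst (_< r) toℕ-u₁ u₁<r) (n<1+n r)

  unmatched⇒u₀⊎u₁ : ∀ {c} → ¬ Matched c → c ≡ u₀ ⊎ c ≡ u₁
  unmatched⇒u₀⊎u₁ {c} c≮r with toℕ c ≟ r
  ... | yes c≡r = inj₁ (toℕ-injective (trans c≡r (sym toℕ-u₀)))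
  ... | no  c≢r = inj₂ (toℕ-injective (trans (≤-antisym c≤1+r r<c) (sym toℕ-u₁)))
    where
    r<c : r < toℕ c
    r<c = ≤∧≢⇒< (≮⇒≥ c≮r) (λ e → c≢r (sym e))
    c≤1+r : toℕ c ≤ suc r
    c≤1+r = ≤-pred (<-≤-trans (toℕ<n c) (≤-reflexive (+-comm r 2)))

  another-unmatched : ∀ w → ∃ λ q → q ≢ w × ¬ Matched q
  another-unmatched w with u₀ ≟ᶠ w
  ... | yes refl = u₁ , (λ e → u₀≢u₁ (sym e)) , unmatched-u₁
  ... | no  u₀≢w = u₀ , u₀≢w , unmatched-u₀

  unmatched-pair : ∀ {a b c} → ¬ Matched a → ¬ Matched b → ¬ Matched c → a ≢ b → c ≡ a ⊎ c ≡ b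
  unmatched-pair a≮ b≮ c≮ a≢b with unmatched⇒u₀⊎u₁ a≮ | unmatched⇒u₀⊎u₁ b≮ | unmatched⇒u₀⊎u₁ c≮
  ... | inj₁ refl | inj₁ refl | _         = ⊥-elim (a≢b refl)
  ... | inj₂ refl | inj₂ refl | _         = ⊥-elim (a≢b refl)
  ... | inj₁ refl | inj₂ refl | inj₁ refl = inj₁ refl
  ... | inj₁ refl | inj₂ refl | inj₂ refl = inj₂ refl
  ... | inj₂ refl | inj₁ refl | inj₁ refl = inj₂ refl
  ... | inj₂ refl | inj₁ refl | inj₂ refl = inj₁ refl

  combine : Side → Subset m → Subset m → Subset (m + m)
  combine left  p q = p ++ q
  combine right p q = q ++ p

  restrict : Side → Subset (m + m) → Subset m
  restrict left  X = take m X
  restrict right X = drop m X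

  lookup-combine : ∀ s p q a → lookup (combine s p q) (vertex s a) ≡ lookup p a
  lookup-combine left  p q a = lookup-++ˡ p q a
  lookup-combine right p q a = lookup-++ʳ q p a

  lookup-combineᵒ : ∀ s p q a → lookup (combine s p q) (vertex (opposite s) a) ≡ lookup q a
  lookup-combineᵒ left  p q a = lookup-++ʳ p q a
  lookup-combineᵒ right p q a = lookup-++ˡ q p a

  combine-restrict : ∀ X → combine left (restrict left X) (restrict right X) ≡ X
  combine-restrict X = take++drop≡id m X

  lookup-restrict : ∀ s X a → lookup (restrict s X) a ≡ lookup X (vertex s a)
  lookup-restrict s X a = begin
    lookup (restrict s X) a         ≡⟨ sym (lookup-combine-restrict s) ⟩
    lookup X′ (vertex s a)          ≡⟨ cong (λ Y → lookup Y (vertex s a)) (combine-restrict X) ⟩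
    lookup X (vertex s a)           ∎
    where
    X′ : Subset (m + m)
    X′ = combine left (restrict left X) (restrict right X)
    lookup-combine-restrict : ∀ s → lookup X′ (vertex s a) ≡ lookup (restrict s X) a
    lookup-combine-restrict left  = lookup-combine left (restrict left X) (restrict right X) a
    lookup-combine-restrict right = lookup-combineᵒ left (restrict left X) (restrict right X) a

  ∣combine∣ : ∀ s p q → ∣ combine s p q ∣ ≡ ∣ p ∣ + ∣ q ∣
  ∣combine∣ left  p q = ∣p++q∣≡∣p∣+∣q∣ p q
  ∣combine∣ right p q = trans (∣p++q∣≡∣p∣+∣q∣ q p) (+-comm ∣ q ∣ ∣ p ∣)

  ∣restrict∣+∣restrict∣ : ∀ X → ∣ restrict left X ∣ + ∣ restrict right X ∣ ≡ ∣ X ∣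
  ∣restrict∣+∣restrict∣ X =
    trans (sym (∣combine∣ left (restrict left X) (restrict right X))) (cong ∣_∣ (combine-restrict X))

  ∣restrict∣≤∣X∣ : ∀ s X → ∣ restrict s X ∣ ≤ ∣ X ∣
  ∣restrict∣≤∣X∣ left  X = ≤-trans (m≤m+n _ _) (≤-reflexive (∣restrict∣+∣restrict∣ X))
  ∣restrict∣≤∣X∣ right X = ≤-trans (m≤n+m _ _) (≤-reflexive (∣restrict∣+∣restrict∣ X))

  module _ (s : Side) {p q : Subset m} {a : Fin m} where

    ∈combine⁺ : a ∈ p → vertex s a ∈ combine s p q
    ∈combine⁺ = ∈-transport (sym (lookup-combine s p q a))

    ∈combine⁻ : vertex s a ∈ combine s p q → a ∈ p
    ∈combine⁻ = ∈-transport (lookup-combine s p q a)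

    ∈combineᵒ⁺ : a ∈ q → vertex (opposite s) a ∈ combine s p q
    ∈combineᵒ⁺ = ∈-transport (sym (lookup-combineᵒ s p q a))

    ∈combineᵒ⁻ : vertex (opposite s) a ∈ combine s p q → a ∈ q
    ∈combineᵒ⁻ = ∈-transport (lookup-combineᵒ s p q a)

  module _ (s : Side) {X : Subset (m + m)} {a : Fin m} where

    ∈restrict⁺ : vertex s a ∈ X → a ∈ restrict s X
    ∈restrict⁺ = ∈-transport (sym (lookup-restrict s X a))

    ∈restrict⁻ : a ∈ restrict s X → vertex s a ∈ X
    ∈restrict⁻ = ∈-transport (lookup-restrict s X a)

  restrict-combine : ∀ s p q → restrict s (combine s p q) ≡ p
  restrict-combine s p q =
    ⊆-antisym (λ a∈ → ∈combine⁻ s {q = q} (∈restrict⁻ s a∈)) (λ a∈ → ∈restrict⁺ s (∈combine⁺ s a∈))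

  restrict-combineᵒ : ∀ s p q → restrict (opposite s) (combine s p q) ≡ q
  restrict-combineᵒ s p q =
    ⊆-antisym (λ a∈ → ∈combineᵒ⁻ s {p} (∈restrict⁻ (opposite s) a∈)) (λ a∈ → ∈restrict⁺ (opposite s) (∈combineᵒ⁺ s a∈))

  restrict-mono : ∀ s {X Y} → X ⊆ Y → restrict s X ⊆ restrict s Y
  restrict-mono s X⊆Y a∈ = ∈restrict⁺ s (X⊆Y (∈restrict⁻ s a∈))

  combine-⊆ : ∀ s {p q X} → (∀ {a} → a ∈ p → vertex s a ∈ X) → (∀ {a} → a ∈ q → vertex (opposite s) a ∈ X) →
    combine s p q ⊆ X
  combine-⊆ s p⇒X q⇒X {v} v∈ with vertex-surjective v
  ... | t , a , refl with t ≟ˢ s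
  ... | yes refl = p⇒X (∈combine⁻ s v∈)
  ... | no  t≢s rewrite ≢⇒≡opposite t≢s = q⇒X (∈combineᵒ⁻ s v∈)

  combine-mono : ∀ s {p p′ q q′} → p ⊆ p′ → q ⊆ q′ → combine s p q ⊆ combine s p′ q′
  combine-mono s p⊆p′ q⊆q′ = combine-⊆ s (λ a∈ → ∈combine⁺ s (p⊆p′ a∈)) (λ a∈ → ∈combineᵒ⁺ s (q⊆q′ a∈))

  -- Skew forcing sets of H(r)

  -- Every neighbour of vertex s x other than vertex s y lies in S, so x can force y once y is white.
  record Ready (s : Side) (S : Subset (m + m)) : Set where
    field
      x y          : Fin m
      x≢y          : x ≢ y
      clique-blue  : ∀ a → a ≢ x → a ≢ y → vertex s a ∈ S
      partner-blue : Matched x → vertex (opposite s) x ∈ S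

  Ready-mono : ∀ {s S T} → S ⊆ T → Ready s S → Ready s T
  Ready-mono S⊆T ρ = record
    { Ready ρ ; clique-blue = λ a a≢x a≢y → S⊆T (clique-blue a a≢x a≢y) ; partner-blue = λ x<r → S⊆T (partner-blue x<r) }
    where open Ready ρ

  Ready-combine : ∀ s {x y q} → x ≢ y → (Matched x → x ∈ q) → Ready s (combine s (allBut x y) q)
  Ready-combine s {x} {y} x≢y x∈q = record
    { x = x ; y = y ; x≢y = x≢y
    ; clique-blue = λ a a≢x a≢y → ∈combine⁺ s (∈allBut⁺ a≢x a≢y)
    ; partner-blue = λ x<r → ∈combineᵒ⁺ s (x∈q x<r)
    }

  ∣allBut∣≡r : ∀ {x y : Fin m} → x ≢ y → ∣ allBut x y ∣ ≡ r
  ∣allBut∣≡r x≢y = trans (∣allBut∣≡n∸2 x≢y) (m+n∸n≡m r 2)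

  ∣combine-allBut∣ : ∀ s {x y : Fin m} q → x ≢ y → ∣ combine s (allBut x y) q ∣ ≡ r + ∣ q ∣
  ∣combine-allBut∣ s q x≢y = trans (∣combine∣ s _ q) (cong (_+ ∣ q ∣) (∣allBut∣≡r x≢y))

  Ready⇒r≤∣restrict∣ : ∀ {s S} → Ready s S → r ≤ ∣ restrict s S ∣
  Ready⇒r≤∣restrict∣ {s} ρ = subst (_≤ _) (∣allBut∣≡r x≢y) (p⊆q⇒∣p∣≤∣q∣ allBut⊆restrict)
    where
    open Ready ρ
    allBut⊆restrict : allBut x y ⊆ restrict s _
    allBut⊆restrict a∈ = let a≢x , a≢y = ∈allBut⁻ a∈ in ∈restrict⁺ s (clique-blue _ a≢x a≢y)

  Ready⇒r≤∣S∣ : ∀ {s S} → Ready s S → r ≤ ∣ S ∣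
  Ready⇒r≤∣S∣ {s} {S} ρ = ≤-trans (Ready⇒r≤∣restrict∣ ρ) (∣restrict∣≤∣X∣ s S)

  SkewForce⇒Ready : ∀ {S u w} → SkewForce (H r) S u w → ∃ λ s → Ready s S
  SkewForce⇒Ready {S} {u} {w} (w∉S , uw , rest) with vertex-surjective u
  ... | s , p , refl with H-neighbour s uw
  ... | inj₁ (q , refl , p≢q) = s , (record
    { x = p ; y = q ; x≢y = p≢q
    ; clique-blue = λ a a≢p a≢q → rest (vertex s a) (H-clique s (λ e → a≢p (sym e))) (vertex-≢ s a≢q)
    ; partner-blue = λ p<r → rest _ (H-matching s p<r) (vertex-opposite-≢ s)
    })
  ... | inj₂ (refl , p<r) = s , (record
    { x = u₀ ; y = p ; x≢y = λ { refl → unmatched-u₀ p<r }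
    ; clique-blue = λ a _ a≢p → rest (vertex s a) (H-clique s (λ e → a≢p (sym e))) (λ e → vertex-opposite-≢ s (sym e))
    ; partner-blue = λ u₀<r → ⊥-elim (unmatched-u₀ u₀<r)
    })

  forcing⇒Ready : ∀ {S} → IsSkewForcingSet (H r) S → ∃ λ s → Ready s S
  forcing⇒Ready (allBlue all∈S) = left , (record
    { x = u₀ ; y = u₁ ; x≢y = u₀≢u₁ ; clique-blue = λ a _ _ → all∈S _ ; partner-blue = λ _ → all∈S _ })
  forcing⇒Ready (force u w f _) = SkewForce⇒Ready f

  Force : Subset (m + m) → Set
  Force S = ∃₂ (SkewForce (H r) S)

  Ready-force : ∀ {s S} (ρ : Ready s S) → vertex s (Ready.y ρ) ∉ S → Force S
  Ready-force {s} {S} ρ y∉S = vertex s x , vertex s y , y∉S , H-clique s x≢y , forced-blue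
    where
    open Ready ρ
    forced-blue : ∀ v → H r (vertex s x) v → v ≢ vertex s y → v ∈ S
    forced-blue v adj v≢y with H-neighbour s adj
    ... | inj₂ (refl , x<r) = partner-blue x<r
    ... | inj₁ (b , refl , x≢b) with b ≟ᶠ y
    ...   | yes refl = ⊥-elim (v≢y refl)
    ...   | no  b≢y  = clique-blue b (λ e → x≢b (sym e)) b≢y

  unmatched-force : ∀ s {S q w} → ¬ Matched q → q ≢ w → vertex s w ∉ S →
    (∀ a → a ≢ q → a ≢ w → vertex s a ∈ S) → Force S
  unmatched-force s {q = q} {w} q≮r q≢w w∉S blue = Ready-force {s} (record
    { x = q ; y = w ; x≢y = q≢w ; clique-blue = blue ; partner-blue = λ q<r → ⊥-elim (q≮r q<r) }) w∉S

  matching-force : ∀ s {S c} → Matched c → (∀ a → vertex s a ∈ S) → vertex (opposite s) c ∉ S → Force S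
  matching-force s {S} {c} c<r full c∉S = vertex s c , vertex (opposite s) c , c∉S , H-matching s c<r , forced-blue
    where
    forced-blue : ∀ v → H r (vertex s c) v → v ≢ vertex (opposite s) c → v ∈ S
    forced-blue v adj v≢c with H-neighbour s adj
    ... | inj₁ (b , refl , _) = full b
    ... | inj₂ (refl , _)     = ⊥-elim (v≢c refl)

  -- Unless a matched vertex of the full clique has a white partner, b is unmatched and is forced
  -- by the other unmatched vertex of its clique.
  full-clique-force : ∀ s {S b} → (∀ a → vertex s a ∈ S) → vertex (opposite s) b ∉ S → Force S
  full-clique-force s {S} {b} full b∉S with any? (λ c → Matched? c ×-dec ¬? (vertex (opposite s) c ∈? S))
  ... | yes (c , c<r , c∉S) = matching-force s c<r full c∉S
  ... | no  no-white-partner with another-unmatched b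
  ... | q , q≢b , q≮r = unmatched-force (opposite s) q≮r q≢b b∉S others-blue
    where
    partner-blue : ∀ a → Matched a → vertex (opposite s) a ∈ S
    partner-blue a a<r with vertex (opposite s) a ∈? S
    ... | yes a∈S = a∈S
    ... | no  a∉S = ⊥-elim (no-white-partner (a , a<r , a∉S))
    b≮r : ¬ Matched b
    b≮r b<r = b∉S (partner-blue b b<r)
    others-blue : ∀ a → a ≢ q → a ≢ b → vertex (opposite s) a ∈ S
    others-blue a a≢q a≢b with Matched? a
    ... | yes a<r = partner-blue a a<r
    ... | no  a≮r = ⊥-elim ([ a≢q , a≢b ] (unmatched-pair q≮r b≮r a≮r q≢b))

  Ready-clique-full : ∀ {s S} (ρ : Ready s S) → vertex s (Ready.x ρ) ∈ S → vertex s (Ready.y ρ) ∈ S →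
    ∀ a → vertex s a ∈ S
  Ready-clique-full ρ x∈S y∈S a with a ≟ᶠ Ready.x ρ | a ≟ᶠ Ready.y ρ
  ... | yes refl | _        = x∈S
  ... | no  _    | yes refl = y∈S
  ... | no  a≢x  | no  a≢y  = Ready.clique-blue ρ a a≢x a≢y

  Ready-force-x : ∀ {s S} (ρ : Ready s S) → vertex s (Ready.y ρ) ∈ S → vertex s (Ready.x ρ) ∉ S → Force S
  Ready-force-x {s} {S} ρ y∈S x∉S with another-unmatched (Ready.x ρ)
  ... | q , q≢x , q≮r = unmatched-force s q≮r q≢x x∉S x-only-white
    where
    open Ready ρ
    x-only-white : ∀ a → a ≢ q → a ≢ x → vertex s a ∈ S
    x-only-white a _ a≢x with a ≟ᶠ y
    ... | yes refl = y∈S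
    ... | no  a≢y  = clique-blue a a≢x a≢y

  Ready-progress : ∀ {s S v} → Ready s S → v ∉ S → Force S
  Ready-progress {s} {S} {v} ρ v∉S with vertex s (Ready.y ρ) ∈? S | vertex s (Ready.x ρ) ∈? S
  ... | no  y∉S | _       = Ready-force ρ y∉S
  ... | yes y∈S | no  x∉S = Ready-force-x ρ y∈S x∉S
  ... | yes y∈S | yes x∈S with vertex-surjective v
  ... | t , b , refl with t ≟ˢ s
  ...   | yes refl = ⊥-elim (v∉S (Ready-clique-full ρ x∈S y∈S b))
  ...   | no  t≢s rewrite ≢⇒≡opposite t≢s = full-clique-force s (Ready-clique-full ρ x∈S y∈S) v∉S

  Ready⇒forcing : ∀ {s S} → Ready s S → IsSkewForcingSet (H r) S
  Ready⇒forcing {s} =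
    SkewDerives-from-invariant (H r) (Ready s) (λ {B} w → Ready-mono (q⊆p∪q ⁅ w ⁆ B)) Ready-progress

  forcing⇒r≤∣S∣ : ∀ {S} → IsSkewForcingSet (H r) S → r ≤ ∣ S ∣
  forcing⇒r≤∣S∣ forcing = Ready⇒r≤∣S∣ (proj₂ (forcing⇒Ready forcing))

  base : Side → Subset (m + m)
  base s = combine s (allBut u₀ u₁) ⊥

  Ready-base : ∀ s → Ready s (base s)
  Ready-base s = Ready-combine s u₀≢u₁ (λ u₀<r → ⊥-elim (unmatched-u₀ u₀<r))

  ∣base∣≡r : ∀ s → ∣ base s ∣ ≡ r
  ∣base∣≡r s = trans (∣combine-allBut∣ s ⊥ u₀≢u₁) (trans (cong (r +_) (∣⊥∣≡0 m)) (+-identityʳ r))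

  skewForcingNumber : SkewForcingNumberIs (H r) r
  skewForcingNumber = (base left , Ready⇒forcing (Ready-base left) , ∣base∣≡r left) , λ _ → forcing⇒r≤∣S∣

  -- The vertices of S that ρ relies on, together with the partner of x even when x is unmatched.
  witness : ∀ {s S} → Ready s S → Subset (m + m)
  witness {s} ρ = combine s (allBut (Ready.x ρ) (Ready.y ρ)) ⁅ Ready.x ρ ⁆

  ∣witness∣≡r+1 : ∀ {s S} (ρ : Ready s S) → ∣ witness ρ ∣ ≡ r + 1
  ∣witness∣≡r+1 {s} ρ = trans (∣combine-allBut∣ s ⁅ Ready.x ρ ⁆ (Ready.x≢y ρ)) (cong (r +_) (∣⁅x⁆∣≡1 (Ready.x ρ)))

  Ready-∩witness : ∀ {s S} (ρ : Ready s S) → Ready s (S ∩ witness ρ)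
  Ready-∩witness {s} ρ = record
    { Ready ρ
    ; clique-blue = λ a a≢x a≢y → x∈p∩q⁺ (clique-blue a a≢x a≢y , ∈combine⁺ s (∈allBut⁺ a≢x a≢y))
    ; partner-blue = λ x<r → x∈p∩q⁺ (partner-blue x<r , ∈combineᵒ⁺ s (x∈⁅x⁆ x))
    }
    where open Ready ρ

  witness⊆ : ∀ {s S} (ρ : Ready s S) → Matched (Ready.x ρ) → witness ρ ⊆ S
  witness⊆ {s} ρ x<r = combine-⊆ s
    (λ a∈ → let a≢x , a≢y = ∈allBut⁻ a∈ in clique-blue _ a≢x a≢y)
    (λ a∈ → subst (λ a → vertex (opposite s) a ∈ _) (sym (x∈⁅y⁆⇒x≡y x a∈)) (partner-blue x<r))
    where open Ready ρ

  minimal⇒∣S∣≤r+1 : ∀ {S} → IsMinimalSkewForcingSet (H r) S → ∣ S ∣ ≤ r + 1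
  minimal⇒∣S∣≤r+1 {S} (forcing , minimal) = bound (proj₂ (forcing⇒Ready forcing))
    where
    bound : ∀ {s} → Ready s S → ∣ S ∣ ≤ r + 1
    bound ρ = ≤-trans (p⊆q⇒∣p∣≤∣q∣ S⊆witness) (≤-reflexive (∣witness∣≡r+1 ρ))
      where
      S⊆witness : S ⊆ witness ρ
      S⊆witness v∈S = x∈p∩q⁻ S (witness ρ)
        (minimal (S ∩ witness ρ) (p∩q⊆p S (witness ρ)) (Ready⇒forcing (Ready-∩witness ρ)) v∈S) .proj₂

  restrict-agree⊆ : ∀ s {X Y} → (∀ a → lookup X (vertex s a) ≡ lookup Y (vertex s a)) → restrict s X ⊆ restrict s Y
  restrict-agree⊆ s {X} {Y} agree {a} a∈ =
    ∈-transport (trans (lookup-restrict s X a) (trans (agree a) (sym (lookup-restrict s Y a)))) a∈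

  left-heavy-preserved : ∀ {k X Y} → k < 2 * r → TARPath (H r) k X Y → ∣ X ∣ ≤ k →
    r ≤ ∣ restrict left X ∣ → r ≤ ∣ restrict left Y ∣
  left-heavy-preserved k<2r here _ heavy = heavy
  left-heavy-preserved {k} {X} k<2r (step {S' = X′} (v , _ , agree) (forcing′ , ∣X′∣≤k) p) ∣X∣≤k heavy =
    left-heavy-preserved k<2r p ∣X′∣≤k heavy′
    where
    heavy′ : r ≤ ∣ restrict left X′ ∣
    heavy′ with vertex-surjective v
    ... | right , c , refl =
      ≤-trans heavy (p⊆q⇒∣p∣≤∣q∣ (restrict-agree⊆ left (λ a → agree _ (vertex-opposite-≢ right))))
    ... | left , c , refl with forcing⇒Ready forcing′
    ...   | left  , ρ = Ready⇒r≤∣restrict∣ ρ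
    ...   | right , ρ = ⊥-elim (<⇒≱ k<2r (≤-trans 2r≤∣X∣ ∣X∣≤k))
      where
      right-heavy : r ≤ ∣ restrict right X ∣
      right-heavy = ≤-trans (Ready⇒r≤∣restrict∣ ρ)
        (p⊆q⇒∣p∣≤∣q∣ (restrict-agree⊆ right (λ a → sym (agree _ (vertex-opposite-≢ left)))))
      2r≤∣X∣ : 2 * r ≤ ∣ X ∣
      2r≤∣X∣ = subst₂ _≤_ (cong (r +_) (sym (+-identityʳ r))) (∣restrict∣+∣restrict∣ X) (+-mono-≤ heavy right-heavy)

  disconnected : ∀ {k} → r ≤ k → k < 2 * r → ¬ TARConnected (H r) k
  disconnected {k} r≤k k<2r connected with subst (λ n → k < 2 * n) (n≤0⇒n≡0 r≤0) k<2r
    where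
    inTAR-base : ∀ s → InTAR (H r) k (base s)
    inTAR-base s = Ready⇒forcing (Ready-base s) , subst (_≤ k) (sym (∣base∣≡r s)) r≤k
    left-heavy : r ≤ ∣ restrict left (base left) ∣
    left-heavy = ≤-reflexive (trans (sym (∣allBut∣≡r u₀≢u₁)) (cong ∣_∣ (sym (restrict-combine left (allBut u₀ u₁) ⊥))))
    r≤0 : r ≤ 0
    r≤0 = subst (r ≤_) (trans (cong ∣_∣ (restrict-combineᵒ right (allBut u₀ u₁) ⊥)) (∣⊥∣≡0 m))
      (left-heavy-preserved k<2r (connected _ _ (inTAR-base left) (inTAR-base right)) (proj₂ (inTAR-base left)) left-heavy)
  ... | ()

  module _ (2≤r : 2 ≤ r) where

    z₀ z₁ : Fin m
    z₀ = fromℕ< {0} (≤-trans (s≤s z≤n) (≤-trans 2≤r (m≤m+n r 2)))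
    z₁ = fromℕ< {1} (≤-trans 2≤r (m≤m+n r 2))

    matched-z₀ : Matched z₀
    matched-z₀ = subst (_< r) (sym (toℕ-fromℕ< _)) (≤-trans (s≤s z≤n) 2≤r)

    matched-z₁ : Matched z₁
    matched-z₁ = subst (_< r) (sym (toℕ-fromℕ< _)) 2≤r

    z₀≢z₁ : z₀ ≢ z₁
    z₀≢z₁ e = 0≢1+n (trans (sym (toℕ-fromℕ< _)) (trans (cong toℕ e) (toℕ-fromℕ< _)))

    -- A forcing subset must be Ready left (the right side holds only one vertex) with x = z₀ and y = z₁
    -- (the partner of z₁ is missing), and then it contains the whole of largeMinimal.
    largeMinimal : Subset (m + m)
    largeMinimal = combine left (allBut z₀ z₁) ⁅ z₀ ⁆

    ∣largeMinimal∣≡r+1 : ∣ largeMinimal ∣ ≡ r + 1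
    ∣largeMinimal∣≡r+1 = trans (∣combine-allBut∣ left ⁅ z₀ ⁆ z₀≢z₁) (cong (r +_) (∣⁅x⁆∣≡1 z₀))

    largeMinimal-minimal : IsMinimalSkewForcingSet (H r) largeMinimal
    largeMinimal-minimal = Ready⇒forcing (Ready-combine left z₀≢z₁ (λ _ → x∈⁅x⁆ z₀)) , minimality
      where
      not-right : ∀ {T} → T ⊆ largeMinimal → ¬ Ready right T
      not-right {T} T⊆ ρ = <-irrefl refl (<-≤-trans 2≤r (≤-trans (Ready⇒r≤∣restrict∣ ρ) ∣restrict∣≤1))
        where
        ∣restrict∣≤1 : ∣ restrict right T ∣ ≤ 1
        ∣restrict∣≤1 = ≤-trans (p⊆q⇒∣p∣≤∣q∣ (restrict-mono right T⊆))
          (≤-reflexive (trans (cong ∣_∣ (restrict-combineᵒ left _ ⁅ z₀ ⁆)) (∣⁅x⁆∣≡1 z₀)))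

      from-left : ∀ {T} → T ⊆ largeMinimal → Ready left T → largeMinimal ⊆ T
      from-left {T} T⊆ ρ
        with ∉allBut⇒∈pair (excluded (λ c≢ → proj₁ c≢ refl)) | ∉allBut⇒∈pair (excluded (λ c≢ → proj₂ c≢ refl))
        where
        open Ready ρ
        excluded : ∀ {c} → ¬ (c ≢ z₀ × c ≢ z₁) → c ∉ allBut x y
        excluded c∈pair c∈ =
          let c≢x , c≢y = ∈allBut⁻ c∈ in c∈pair (∈allBut⁻ (∈combine⁻ left (T⊆ (clique-blue _ c≢x c≢y))))
      ... | inj₁ z₀≡x | inj₂ z₁≡y =
        subst (_⊆ T) (sym (cong₂ (λ a b → combine left (allBut a b) ⁅ a ⁆) z₀≡x z₁≡y))
          (witness⊆ ρ (subst Matched z₀≡x matched-z₀))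
      ... | inj₂ z₀≡y | inj₁ z₁≡x = ⊥-elim (z₀≢z₁ (trans (sym x≡z₀) (sym z₁≡x)))
        where
        x≡z₀ : Ready.x ρ ≡ z₀
        x≡z₀ = x∈⁅y⁆⇒x≡y z₀ (∈combineᵒ⁻ left (T⊆ (Ready.partner-blue ρ (subst Matched z₁≡x matched-z₁))))
      ... | inj₁ z₀≡x | inj₁ z₁≡x = ⊥-elim (z₀≢z₁ (trans z₀≡x (sym z₁≡x)))
      ... | inj₂ z₀≡y | inj₂ z₁≡y = ⊥-elim (z₀≢z₁ (trans z₀≡y (sym z₁≡y)))

      minimality : ∀ T → T ⊆ largeMinimal → IsSkewForcingSet (H r) T → largeMinimal ⊆ T
      minimality T T⊆ forcing with forcing⇒Ready forcing
      ... | left  , ρ = from-left T⊆ ρ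
      ... | right , ρ = ⊥-elim (not-right T⊆ ρ)

    upperSkewForcingNumber : UpperSkewForcingNumberIs (H r) (r + 1)
    upperSkewForcingNumber = (largeMinimal , largeMinimal-minimal , ∣largeMinimal∣≡r+1) , λ _ → minimal⇒∣S∣≤r+1

    hub : Side → Subset (m + m)
    hub s = combine s ⊤ ⊥

    ∣hub∣≡m : ∀ s → ∣ hub s ∣ ≡ m
    ∣hub∣≡m s = trans (∣combine∣ s ⊤ ⊥) (trans (cong₂ _+_ (∣⊤∣≡n m) (∣⊥∣≡0 m)) (+-identityʳ m))

    base⊆hub : ∀ s → base s ⊆ hub s
    base⊆hub s = combine-mono s ⊆⊤ ⊆-refl

    m≤2r : m ≤ 2 * r
    m≤2r = +-monoʳ-≤ r (≤-trans 2≤r (≤-reflexive (sym (+-identityʳ r))))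

    module _ {k : ℕ} (2r≤k : 2 * r ≤ k) where

      inTAR-hub : ∀ s → InTAR (H r) k (hub s)
      inTAR-hub s = SkewDerives-mono (H r) (Ready⇒forcing (Ready-base s)) (base⊆hub s) ,
                    ≤-trans (≤-reflexive (∣hub∣≡m s)) (≤-trans m≤2r 2r≤k)

      -- Through the witness of S inside K = combine s (∁ ⁅ y ⁆) ⁅ x ⁆, then down to combine s (∁ ⁅ y ⁆) ⊥,
      -- which is Ready via an unmatched vertex other than y.
      path-to-hub : ∀ {s S} → Ready s S → ∣ S ∣ ≤ k → TARPath (H r) k S (hub s)
      path-to-hub {s} {S} ρ ∣S∣≤k with another-unmatched (Ready.y ρ)
      ... | q , q≢y , q≮r =
        path-via (p∩q⊆p S (witness ρ)) (⊆-trans (p∩q⊆q S (witness ρ)) witness⊆K)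
          (Ready⇒forcing (Ready-∩witness ρ)) ∣S∣≤k ∣K∣≤k
        ◅◅ path-via (combine-mono s ⊆-refl ⊥⊆) (combine-mono s ⊆⊤ ⊆-refl) (Ready⇒forcing Ready-R) ∣K∣≤k (proj₂ (inTAR-hub s))
        where
        open Ready ρ
        K : Subset (m + m)
        K = combine s (∁ ⁅ y ⁆) ⁅ x ⁆
        witness⊆K : witness ρ ⊆ K
        witness⊆K = combine-mono s allBut⊆∁⁅y⁆ ⊆-refl
        ∣K∣≡1+∣∁y∣ : ∣ K ∣ ≡ suc ∣ ∁ ⁅ y ⁆ ∣
        ∣K∣≡1+∣∁y∣ = trans (∣combine∣ s (∁ ⁅ y ⁆) ⁅ x ⁆) (trans (cong (∣ ∁ ⁅ y ⁆ ∣ +_) (∣⁅x⁆∣≡1 x)) (+-comm ∣ ∁ ⁅ y ⁆ ∣ 1))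
        ∣K∣≤k : ∣ K ∣ ≤ k
        ∣K∣≤k = ≤-trans (≤-reflexive ∣K∣≡1+∣∁y∣) (≤-trans (x∉p⇒∣p∣<n (x∈p⇒x∉∁p (x∈⁅x⁆ y))) (≤-trans m≤2r 2r≤k))
        Ready-R : Ready s (combine s (∁ ⁅ y ⁆) ⊥)
        Ready-R = Ready-mono (combine-mono s allBut⊆∁⁅y⁆ ⊆-refl) (Ready-combine s q≢y (λ q<r → ⊥-elim (q≮r q<r)))

      -- Both bases fit inside combine left (allBut u₀ u₁) (allBut u₀ u₁), which has exactly 2r vertices.
      hub-path : TARPath (H r) k (hub left) (hub right)
      hub-path =
        path-via (base⊆hub left) (combine-mono left ⊆-refl ⊥⊆) (Ready⇒forcing (Ready-base left))
          (proj₂ (inTAR-hub left)) ∣both∣≤k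
        ◅◅ path-via (combine-mono right ⊆-refl ⊥⊆) (base⊆hub right) (Ready⇒forcing (Ready-base right))
          ∣both∣≤k (proj₂ (inTAR-hub right))
        where
        ∣both∣≤k : ∣ combine left (allBut u₀ u₁) (allBut u₀ u₁) ∣ ≤ k
        ∣both∣≤k = ≤-trans (≤-reflexive (trans (∣combine-allBut∣ left (allBut u₀ u₁) u₀≢u₁)
                     (cong (r +_) (trans (∣allBut∣≡r u₀≢u₁) (sym (+-identityʳ r)))))) 2r≤k

      hubs-connected : ∀ s t → TARPath (H r) k (hub s) (hub t)
      hubs-connected left  left  = here
      hubs-connected right right = here
      hubs-connected left  right = hub-path
      hubs-connected right left  = reverse (inTAR-hub left) hub-path

      connected : TARConnected (H r) k
      connected S T (forcingS , ∣S∣≤k) inT@(forcingT , ∣T∣≤k) with forcing⇒Ready forcingS | forcing⇒Ready forcingT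
      ... | s , ρ | t , σ = path-to-hub ρ ∣S∣≤k ◅◅ hubs-connected s t ◅◅ reverse inT (path-to-hub σ ∣T∣≤k)

    skewTARThreshold : SkewTARConnThresholdIs (H r) (2 * r)
    skewTARThreshold = (λ k 2r≤k → connected 2r≤k) , threshold-minimal
      where
      threshold-minimal : ∀ k₀ → (∀ k → k₀ ≤ k → TARConnected (H r) k) → 2 * r ≤ k₀
      threshold-minimal k₀ connected-above with 2 * r ≤? k₀
      ... | yes 2r≤k₀ = 2r≤k₀
      ... | no  2r≰k₀ =
        ⊥-elim (disconnected (m≤n⊔m k₀ r) (⊔-lub (≰⇒> 2r≰k₀) r<2r) (connected-above (k₀ ⊔ r) (m≤m⊔n k₀ r)))
        where
        r<2r : r < 2 * r
        r<2r = m<m+n r (<-≤-trans (s≤s z≤n) (≤-trans 2≤r (≤-reflexive (sym (+-identityʳ r)))))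

proposition5p9 : (r : ℕ) → 2 ≤ r →
    SkewForcingNumberIs (H r) r
    × UpperSkewForcingNumberIs (H r) (r + 1)
    × SkewTARConnThresholdIs (H r) (2 * r)
proposition5p9 r 2≤r = skewForcingNumber r , upperSkewForcingNumber r 2≤r , skewTARThreshold r 2≤r
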